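{- Let $n\in\mathbb{N}$ and let $n=2^{\alpha_1}-2^{\alpha_2}+\cdots+(-1)^{\ell-1}2^{\alpha_\ell}$ be an alternating binary representation of $n$. Then $c(n)=\ell$ if $n$ is odd (i.e. $\alpha_\ell=0$) and $c(n)=\ell+1$ if $n$ is even (i.e. $\alpha_\ell\ge1$). Consequently $h(n)=\ell-1$ if $n$ is odd and $h(n)=\ell$ if $n$ is even.
   Context: An alternating binary representation (ABR) of $n\in\mathbb{N}$ is an expression $n=2^{\alpha_1}-2^{\alpha_2}+\cdots+(-1)^{\ell-1}2^{\alpha_\ell}$ with $\ell\ge1$ and nonnegative integers $\alpha_1>\alpha_2>\cdots>\alpha_{\ell-1}>\alpha_\ell+1$. For $i\in\mathbb{N}$ and $n\in\mathbb{N}_0$, $d_i(n)=2^{i-1}-\left|(n\bmod 2^i)-2^{i-1}\right|$. $c(n)$ is the number of distinct values in $\{d_i(n):i\in\mathbb{N}\}$, and $h(n)=c(n)-1$; for $n\ge2$, $h(n)$ equals the number of pairs $(n_0,n_1)$ of integers with $n_0\ge n_1\ge1$, $n_0+n_1=n$ and $n_0-n_1=d_i(n)$ for some $i\in\{1,\ldots,\lceil\lg n\rceil\}$ (the hypercubic bipartitions of $n$), $\lg$ being the base-2 logarithm. -}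

module Defs where

open import Data.Nat using (ℕ; zero; suc; _+_; _∸_; _^_; _≤_; _<_; ∣_-_∣)
open import Data.Nat.DivMod using (_%_)
open import Data.Nat.Properties using (m^n≢0)
open import Data.Integer as ℤ using (ℤ; +_)
open import Data.List using (List; []; _∷_; length)
open import Data.List.Membership.Propositional using (_∈_)
open import Data.List.Relation.Unary.Unique.Propositional using (Unique)
open import Data.Product using (Σ; _×_; ∃-syntax)
open import Data.Unit using (⊤)
open import Data.Empty using (⊥)
open import Function.Bundles using (_⇔_)
open import Relation.Binary.PropositionalEquality using (_≡_)

ValidABR : List ℕ → Set
ValidABR []                = ⊥
ValidABR (a ∷ [])          = ⊤
ValidABR (a ∷ b ∷ [])      = b + 1 < a
ValidABR (a ∷ b ∷ c ∷ rs)  = b < a × ValidABR (b ∷ c ∷ rs)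

altValue : List ℕ → ℤ
altValue []       = + 0
altValue (a ∷ as) = (+ (2 ^ a)) ℤ.- altValue as

IsABR : ℕ → List ℕ → Set
IsABR n αs = ValidABR αs × altValue αs ≡ + n

-- d_i(n) = 2^(i-1) - |(n mod 2^i) - 2^(i-1)|  (only used for i ≥ 1;
-- the truncated subtraction is exact since n mod 2^i < 2^i).
d : ℕ → ℕ → ℕ
d i n = 2 ^ (i ∸ 1) ∸ ∣ _%_ n (2 ^ i) {{m^n≢0 2 i}} - 2 ^ (i ∸ 1) ∣

DistinctValues : ℕ → List ℕ → Set
DistinctValues n xs =
  Unique xs × (∀ v → (v ∈ xs) ⇔ (∃[ i ] (1 ≤ i × d i n ≡ v)))

CEq : ℕ → ℕ → Set
CEq n k = Σ (List ℕ) λ xs → DistinctValues n xs × length xs ≡ k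

HEq : ℕ → ℕ → Set
HEq n k = Σ (List ℕ) λ xs → DistinctValues n xs × length xs ∸ 1 ≡ k

-- For 0 < i, d i n is the distance from n to the nearest multiple of 2 ^ i, so
-- d i n = d i m whenever 2 ^ i divides n + m. Write an ABR as n = 2 ^ (a + 1) − m,
-- where m (the value of the tail) satisfies 2m < 2 ^ (a + 1). For i ≤ a + 1 this gives
-- d i n = d i m, while for larger i both d i n = n and d i m = m = d (a + 1) m.
-- Hence the values of n are those of m together with the new value n, which exceeds
-- every value of m. Peeling off exponents down to the empty tail (value 0, whose only
-- value is 0), every exponent contributes one value and the final 0 survives exactly
-- when the last exponent is positive, i.e. when n is even.
module Submission where

open import Defs
open import Data.Nat
  using (ℕ; zero; suc; _+_; _*_; _∸_; _^_; _%_; _≤_; _<_; ∣_-_∣; z≤n; s≤s; NonZero; _≤?_; _<?_)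
open import Data.Nat.Properties
open import Data.Nat.DivMod
  using (m<n⇒m%n≡m; m%n<n; m%n≤m; %-distribˡ-+; n%1≡0; m≤n⇒[n∸m]%m≡n%m)
open import Data.Nat.Divisibility using (_∣_; divides; n∣m⇒m%n≡0)
import Data.Integer as ℤ
import Data.Integer.Properties as ℤ
open import Data.List using (List; []; _∷_; length)
open import Data.List.Relation.Unary.Any using (here; there)
open import Data.List.Relation.Unary.All as All using ([])
open import Data.List.Relation.Unary.AllPairs using ([]; _∷_)
open import Data.List.Membership.Propositional using (_∈_)
open import Data.Product using (_×_; _,_; ∃-syntax)
open import Data.Sum using (_⊎_; inj₁; inj₂; map₁)
open import Data.Unit using (tt)
open import Function.Bundles using (mk⇔; Equivalence)
open import Relation.Nullary using (yes; no)
open import Relation.Binary.PropositionalEquality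
  using (_≡_; _≢_; refl; sym; trans; cong; subst; module ≡-Reasoning)

^-mono-∣ : ∀ m {i j} → i ≤ j → m ^ i ∣ m ^ j
^-mono-∣ m {i} {j} i≤j = divides (m ^ (j ∸ i)) (begin
  m ^ j                ≡⟨ cong (m ^_) (sym (m∸n+n≡m i≤j)) ⟩
  m ^ (j ∸ i + i)      ≡⟨ ^-distribˡ-+-* m (j ∸ i) i ⟩
  m ^ (j ∸ i) * m ^ i  ∎)
  where open ≡-Reasoning

2^[1+j]≡2^j+2^j : ∀ j → 2 ^ suc j ≡ 2 ^ j + 2 ^ j
2^[1+j]≡2^j+2^j j = cong (2 ^ j +_) (+-identityʳ (2 ^ j))

m+m<n+n⇒m<n : ∀ {m n} → m + m < n + n → m < n
m+m<n+n⇒m<n m+m<n+n = ≰⇒> λ n≤m → <⇒≱ m+m<n+n (+-mono-≤ n≤m n≤m)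

2*m<n⇒m<n : ∀ m {n} → 2 * m < n → m < n
2*m<n⇒m<n m = ≤-<-trans (m≤m+n m (1 * m))

2*m<n⇒m<n∸m : ∀ m {n} → 2 * m < n → m < n ∸ m
2*m<n⇒m<n∸m m {n} 2m<n = m+n≤o⇒m≤o∸n (suc m) (subst (λ k → suc (m + k) ≤ n) (+-identityʳ m) 2m<n)

m%n≡0⇒m<n+n⇒m≡0⊎m≡n : ∀ {m n} .{{_ : NonZero n}} → m % n ≡ 0 → m < n + n → m ≡ 0 ⊎ m ≡ n
m%n≡0⇒m<n+n⇒m≡0⊎m≡n {m} {n} m%n≡0 m<2n with m <? n
... | yes m<n = inj₁ (trans (sym (m<n⇒m%n≡m m<n)) m%n≡0)
... | no m≮n = inj₂ (≤-antisym (m∸n≡0⇒m≤n m∸n≡0) n≤m)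
  where
  n≤m : n ≤ m
  n≤m = ≮⇒≥ m≮n
  m∸n≡0 : m ∸ n ≡ 0
  m∸n≡0 = trans (sym (m<n⇒m%n≡m (m<n+o⇒m∸n<o m n m<2n))) (trans (m≤n⇒[n∸m]%m≡n%m n≤m) m%n≡0)

residues-of-multiple : ∀ {x y K} .{{_ : NonZero K}} → K ∣ x + y →
                       (x % K ≡ 0 × y % K ≡ 0) ⊎ x % K + y % K ≡ K
residues-of-multiple {x} {y} {K} K∣x+y =
  map₁ (λ s≡0 → m+n≡0⇒m≡0 (x % K) s≡0 , m+n≡0⇒n≡0 (x % K) s≡0)
       (m%n≡0⇒m<n+n⇒m≡0⊎m≡n residue-sum%K≡0 (+-mono-< (m%n<n x K) (m%n<n y K)))
  where
  residue-sum%K≡0 : (x % K + y % K) % K ≡ 0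
  residue-sum%K≡0 = trans (sym (%-distribˡ-+ x y K)) (n∣m⇒m%n≡0 _ K K∣x+y)

-- d (suc j) n unfolds to tent (2 ^ j) (n % 2 ^ suc j).
tent : ℕ → ℕ → ℕ
tent h r = h ∸ ∣ r - h ∣

tent-small : ∀ {h r} → r ≤ h → tent h r ≡ r
tent-small {h} r≤h = trans (cong (h ∸_) (m≤n⇒∣m-n∣≡n∸m r≤h)) (m∸[m∸n]≡n r≤h)

tent-≤ : ∀ h r → tent h r ≤ r
tent-≤ h r with r ≤? h
... | yes r≤h = ≤-reflexive (tent-small r≤h)
... | no r≰h = ≤-trans (m∸n≤m h ∣ r - h ∣) (<⇒≤ (≰⇒> r≰h))

∣-∣-reflect : ∀ {x r h} → x ≤ h → x + r ≡ h + h → ∣ x - h ∣ ≡ ∣ r - h ∣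
∣-∣-reflect {x} {r} {h} x≤h x+r≡h+h = begin
  ∣ x - h ∣             ≡⟨ m≤n⇒∣m-n∣≡n∸m x≤h ⟩
  h ∸ x                 ≡⟨ ∣m-m+n∣≡n h (h ∸ x) ⟨
  ∣ h - h + (h ∸ x) ∣   ≡⟨ ∣-∣-comm h (h + (h ∸ x)) ⟩
  ∣ h + (h ∸ x) - h ∣   ≡⟨ cong ∣_- h ∣ r≡h+[h∸x] ⟨
  ∣ r - h ∣             ∎
  where
  open ≡-Reasoning
  r≡h+[h∸x] : r ≡ h + (h ∸ x)
  r≡h+[h∸x] = +-cancelˡ-≡ x r (h + (h ∸ x)) (begin
    x + r              ≡⟨ x+r≡h+h ⟩
    h + h              ≡⟨ cong (h +_) (m+[n∸m]≡n x≤h) ⟨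
    h + (x + (h ∸ x))  ≡⟨ +-assoc h x (h ∸ x) ⟨
    h + x + (h ∸ x)    ≡⟨ cong (_+ (h ∸ x)) (+-comm h x) ⟩
    x + h + (h ∸ x)    ≡⟨ +-assoc x h (h ∸ x) ⟩
    x + (h + (h ∸ x))  ∎)

tent-reflect : ∀ {x r h} → x + r ≡ h + h → tent h x ≡ tent h r
tent-reflect {x} {r} {h} x+r≡h+h with ≤-total x h
... | inj₁ x≤h = cong (h ∸_) (∣-∣-reflect x≤h x+r≡h+h)
... | inj₂ h≤x = cong (h ∸_) (sym (∣-∣-reflect r≤h (trans (+-comm r x) x+r≡h+h)))
  where
  r≤h : r ≤ h
  r≤h = +-cancelˡ-≤ h r h (subst (h + r ≤_) x+r≡h+h (+-monoˡ-≤ r h≤x))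

d-≤ : ∀ i n → d i n ≤ n
d-≤ i n = ≤-trans (tent-≤ (2 ^ (i ∸ 1)) _) (m%n≤m n (2 ^ i) {{m^n≢0 2 i}})

d-small : ∀ j n → n ≤ 2 ^ j → d (suc j) n ≡ n
d-small j n n≤2^j = trans (cong (tent (2 ^ j)) n%2^[1+j]≡n) (tent-small n≤2^j)
  where
  n%2^[1+j]≡n : _%_ n (2 ^ suc j) {{m^n≢0 2 (suc j)}} ≡ n
  n%2^[1+j]≡n = m<n⇒m%n≡m {{m^n≢0 2 (suc j)}} (≤-<-trans n≤2^j (^-monoʳ-< 2 (s≤s (s≤s z≤n)) (n<1+n j)))

d-1 : ∀ n → d 1 n ≡ n % 2
d-1 n = tent-small (≤-pred (m%n<n n 2))

d-negate : ∀ i {n m} → 2 ^ i ∣ n + m → d i n ≡ d i m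
d-negate zero {n} {m} _ = cong (tent 1) (trans (n%1≡0 n) (sym (n%1≡0 m)))
d-negate (suc j) {n} {m} 2^i∣n+m with residues-of-multiple {{m^n≢0 2 (suc j)}} 2^i∣n+m
... | inj₁ (n≡0 , m≡0) = cong (tent (2 ^ j)) (trans n≡0 (sym m≡0))
... | inj₂ residues-sum =
  tent-reflect {residue n} {residue m} (trans residues-sum (2^[1+j]≡2^j+2^j j))
  where
  residue : ℕ → ℕ
  residue k = _%_ k (2 ^ suc j) {{m^n≢0 2 (suc j)}}

d-complement : ∀ {i a} n m → i ≤ a → n + m ≡ 2 ^ a → d i n ≡ d i m
d-complement {i} n m i≤a n+m≡2^a = d-negate i (subst (2 ^ i ∣_) (sym n+m≡2^a) (^-mono-∣ 2 i≤a))

DValue : ℕ → ℕ → Set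
DValue n v = ∃[ i ] (1 ≤ i × d i n ≡ v)

distinctValues-singleton : ∀ {n} → (∀ {i} → 1 ≤ i → d i n ≡ n) → DistinctValues n (n ∷ [])
distinctValues-singleton {n} d≡n = ([] ∷ []) , λ v → mk⇔ (to v) (from v)
  where
  to : ∀ v → v ∈ n ∷ [] → DValue n v
  to v (here refl) = 1 , ≤-refl , d≡n ≤-refl
  from : ∀ v → DValue n v → v ∈ n ∷ []
  from v (i , 1≤i , dᵢn≡v) = here (trans (sym dᵢn≡v) (d≡n 1≤i))

distinctValues-complement : ∀ a {n m xs} → n + m ≡ 2 ^ suc a → m < n →
                            DistinctValues m xs → DistinctValues n (n ∷ xs)
distinctValues-complement a {n} {m} {xs} n+m≡2^[1+a] m<n (unique , values) =
  (All.tabulate fresh ∷ unique) , λ v → mk⇔ (to v) (from v)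
  where
  open ≡-Reasoning
  m<2^a : m < 2 ^ a
  m<2^a = m+m<n+n⇒m<n (subst (m + m <_) (trans n+m≡2^[1+a] (2^[1+j]≡2^j+2^j a)) (+-monoˡ-< m m<n))
  low : ∀ {i} → i ≤ suc a → d i n ≡ d i m
  low i≤1+a = d-complement n m i≤1+a n+m≡2^[1+a]
  high-n : ∀ {i} → suc a < i → d i n ≡ n
  high-n {suc j} (s≤s 1+a≤j) =
    d-small j n (≤-trans (m+n≤o⇒m≤o n (≤-reflexive n+m≡2^[1+a])) (^-monoʳ-≤ 2 1+a≤j))
  high-m : ∀ {i} → suc a ≤ i → d i m ≡ m
  high-m {suc j} (s≤s a≤j) = d-small j m (≤-trans (<⇒≤ m<2^a) (^-monoʳ-≤ 2 a≤j))
  fresh : ∀ {x} → x ∈ xs → n ≢ x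
  fresh {x} x∈xs n≡x with Equivalence.to (values x) x∈xs
  ... | i , _ , dᵢm≡x = <⇒≱ m<n (subst (_≤ m) (trans dᵢm≡x (sym n≡x)) (d-≤ i m))
  to : ∀ v → v ∈ n ∷ xs → DValue n v
  to v (here refl) = suc (suc a) , s≤s z≤n , high-n ≤-refl
  to v (there v∈xs) with Equivalence.to (values v) v∈xs
  ... | i , 1≤i , dᵢm≡v with i ≤? suc a
  ...   | yes i≤1+a = i , 1≤i , trans (low i≤1+a) dᵢm≡v
  ...   | no i≰1+a = suc a , s≤s z≤n , (begin
    d (suc a) n  ≡⟨ low ≤-refl ⟩
    d (suc a) m  ≡⟨ high-m ≤-refl ⟩
    m            ≡⟨ high-m (<⇒≤ (≰⇒> i≰1+a)) ⟨
    d i m        ≡⟨ dᵢm≡v ⟩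
    v            ∎)
  from : ∀ v → DValue n v → v ∈ n ∷ xs
  from v (i , 1≤i , dᵢn≡v) with i ≤? suc a
  ... | yes i≤1+a = there (Equivalence.from (values v) (i , 1≤i , trans (sym (low i≤1+a)) dᵢn≡v))
  ... | no i≰1+a = here (trans (sym dᵢn≡v) (high-n (≰⇒> i≰1+a)))

CEq-complement : ∀ a {n m ℓ} → n + m ≡ 2 ^ suc a → m < n →
                 CEq m (ℓ + (1 ∸ m % 2)) → CEq n (suc ℓ + (1 ∸ n % 2))
CEq-complement a {n} {m} {ℓ} n+m≡2^[1+a] m<n (xs , distinct , length≡) =
  (n ∷ xs) , distinctValues-complement a n+m≡2^[1+a] m<n distinct ,
  cong suc (trans length≡ (cong (λ r → ℓ + (1 ∸ r)) m%2≡n%2))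
  where
  d₁n≡d₁m : d 1 n ≡ d 1 m
  d₁n≡d₁m = d-complement n m (s≤s (z≤n {a})) n+m≡2^[1+a]
  m%2≡n%2 : m % 2 ≡ n % 2
  m%2≡n%2 = trans (sym (d-1 m)) (trans (sym d₁n≡d₁m) (d-1 n))

val : List ℕ → ℕ
val []       = 0
val (a ∷ αs) = 2 ^ a ∸ val αs

ValidABR-tail : ∀ {a b αs} → ValidABR (a ∷ b ∷ αs) → ValidABR (b ∷ αs)
ValidABR-tail {αs = []}    _           = tt
ValidABR-tail {αs = _ ∷ _} (_ , valid) = valid

val-tail-small : ∀ {a} αs → ValidABR (a ∷ αs) → 2 * val αs < 2 ^ a
val-positive : ∀ {a} αs → ValidABR (a ∷ αs) → 0 < val (a ∷ αs)

val-tail-small {a} [] _ = m^n>0 2 a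
val-tail-small {a} (b ∷ []) b+1<a = ^-monoʳ-< 2 (s≤s (s≤s z≤n)) (subst (_< a) (+-comm b 1) b+1<a)
val-tail-small {a} (b ∷ c ∷ αs) (b<a , valid) = <-≤-trans
  (*-monoʳ-< 2 (∸-monoʳ-< (val-positive αs (ValidABR-tail valid))
                          (<⇒≤ (2*m<n⇒m<n (val (c ∷ αs)) (val-tail-small (c ∷ αs) valid)))))
  (^-monoʳ-≤ 2 b<a)

val-positive αs valid = m<n⇒0<n∸m (2*m<n⇒m<n (val αs) (val-tail-small αs valid))

altValue≡val : ∀ {a} αs → ValidABR (a ∷ αs) → altValue (a ∷ αs) ≡ ℤ.+ val (a ∷ αs)
altValue≡val {a} αs valid = begin
  ℤ.+ (2 ^ a) ℤ.- altValue αs  ≡⟨ cong (λ z → ℤ.+ (2 ^ a) ℤ.- z) (tail-altValue≡val αs valid) ⟩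
  ℤ.+ (2 ^ a) ℤ.- ℤ.+ val αs   ≡⟨ ℤ.m-n≡m⊖n (2 ^ a) (val αs) ⟩
  2 ^ a ℤ.⊖ val αs             ≡⟨ ℤ.⊖-≥ (<⇒≤ (2*m<n⇒m<n (val αs) (val-tail-small αs valid))) ⟩
  ℤ.+ (2 ^ a ∸ val αs)         ∎
  where
  open ≡-Reasoning
  tail-altValue≡val : ∀ αs → ValidABR (a ∷ αs) → altValue αs ≡ ℤ.+ val αs
  tail-altValue≡val []       _     = refl
  tail-altValue≡val (_ ∷ βs) valid = altValue≡val βs (ValidABR-tail valid)

CEq-val : ∀ a αs → ValidABR (a ∷ αs) → CEq (val (a ∷ αs)) (length (a ∷ αs) + (1 ∸ val (a ∷ αs) % 2))
CEq-val zero [] _ =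
  (1 ∷ []) , distinctValues-singleton (λ { {suc j} _ → d-small j 1 (m^n>0 2 j) }) , refl
CEq-val (suc a) [] _ =
  CEq-complement a (+-identityʳ (2 ^ suc a)) (m^n>0 2 (suc a))
    ((0 ∷ []) , distinctValues-singleton (λ {i} _ → n≤0⇒n≡0 (d-≤ i 0)) , refl)
CEq-val zero (b ∷ []) ()
CEq-val zero (b ∷ _ ∷ _) (() , _)
CEq-val (suc a) (b ∷ αs) valid =
  CEq-complement a (m∸n+n≡m {n = m} (<⇒≤ m<2^[1+a])) (2*m<n⇒m<n∸m m 2m<2^[1+a])
    (CEq-val b αs (ValidABR-tail valid))
  where
  m = val (b ∷ αs)
  2m<2^[1+a] : 2 * m < 2 ^ suc a
  2m<2^[1+a] = val-tail-small (b ∷ αs) valid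
  m<2^[1+a] : m < 2 ^ suc a
  m<2^[1+a] = 2*m<n⇒m<n m 2m<2^[1+a]

CEq⇒CEq×HEq : ∀ {n k} → CEq n k → CEq n k × HEq n (k ∸ 1)
CEq⇒CEq×HEq c@(xs , distinct , length≡k) = c , (xs , distinct , cong (_∸ 1) length≡k)

theorem20 : (n : ℕ) → 1 ≤ n → (αs : List ℕ) → IsABR n αs →
    ((n % 2 ≡ 1 → CEq n (length αs) × HEq n (length αs ∸ 1))
    × (n % 2 ≡ 0 → CEq n (suc (length αs)) × HEq n (length αs)))
theorem20 n _ [] (() , _)
theorem20 n _ αs@(a ∷ βs) (valid , altValue≡n) = odd , even
  where
  ℓ : ℕ
  ℓ = length αs
  val≡n : val αs ≡ n
  val≡n = ℤ.+-injective (trans (sym (altValue≡val βs valid)) altValue≡n)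
  count : CEq n (ℓ + (1 ∸ n % 2))
  count = subst (λ k → CEq k (ℓ + (1 ∸ k % 2))) val≡n (CEq-val a βs valid)
  odd : n % 2 ≡ 1 → CEq n ℓ × HEq n (ℓ ∸ 1)
  odd n%2≡1 = CEq⇒CEq×HEq (subst (CEq n) (trans (cong (λ r → ℓ + (1 ∸ r)) n%2≡1) (+-identityʳ ℓ)) count)
  even : n % 2 ≡ 0 → CEq n (suc ℓ) × HEq n ℓ
  even n%2≡0 = CEq⇒CEq×HEq (subst (CEq n) (trans (cong (λ r → ℓ + (1 ∸ r)) n%2≡0) (+-comm ℓ 1)) count)
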